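{- If $n = ab$ with $a,b$ positive integers and $a < b$, then $\lambda(n) \le b$.
   Context: All posets are finite. A linear extension of a poset $P=(X,\preceq)$ is a total ordering of $X$ compatible with $\preceq$; $e(P)$ denotes the number of linear extensions of $P$. The size $|P|$ of $P$ is $|X|$. For an integer $n\ge 1$, $\lambda(n)=\min\{|P| : e(P)=n\}$ (the empty poset has exactly one linear extension, so $\lambda(1)=0$). -}

module Defs where

open import Level using (0ℓ)
open import Data.Nat using (ℕ; _≤_)
open import Data.Fin using (Fin) renaming (_≤_ to _≤ᶠ_)
open import Data.Vec using (Vec; lookup)
open import Data.List using (List; length)
open import Data.List.Membership.Propositional using (_∈_)
open import Data.List.Relation.Unary.Unique.Propositional using (Unique)
open import Data.Product using (Σ; _×_; ∃-syntax)
open import Function.Bundles using (_⇔_)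
open import Relation.Binary.PropositionalEquality using (_≡_)
open import Relation.Binary.Structures using (IsPartialOrder)

record Poset (m : ℕ) : Set₁ where
  field
    _≼_       : Fin m → Fin m → Set
    isPartialOrder : IsPartialOrder _≡_ _≼_

-- A linear extension of P, written as the list of the elements in the
-- total order (position i holds the i-th element): every element occurs
-- exactly once, and x ≼ y implies x occurs no later than y.
record IsLinExt {m : ℕ} (P : Poset m) (v : Vec (Fin m) m) : Set where
  open Poset P
  field
    injective  : ∀ i j → lookup v i ≡ lookup v j → i ≡ j
    compatible : ∀ i j → lookup v i ≼ lookup v j → i ≤ᶠ j

NumLinExt : {m : ℕ} → Poset m → ℕ → Set
NumLinExt {m} P n =
  Σ (List (Vec (Fin m) m)) λ xs →
    (length xs ≡ n) × Unique xs × (∀ v → (v ∈ xs) ⇔ IsLinExt P v)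

-- λ(n) ≤ k : some poset of size at most k has exactly n linear extensions
-- (λ(n) is the minimum of such sizes).
λ≤ : ℕ → ℕ → Set₁
λ≤ n k = ∃[ m ] (m ≤ k × Σ (Poset m) λ P → NumLinExt P n)

module Submission where

-- Everything is built from one operation, adjoin D P: add a new point 0 to
-- a poset P on Fin m, below every old point (D = ⊤) or incomparable to all
-- of them (D = ⊥).  Every linear extension of adjoin D P is obtained by
-- inserting the new point into a linear extension of P, uniquely, at a
-- position p with D → p ≡ 0 (insertNew-onto, linExt-insertNew and its
-- converse).  Counting the pairs gives numLinExt-adjoin, whence an
-- isolated point multiplies e(P) by m + 1 and a new minimum keeps e(P).
--
-- For a = k + 1 and b = a + 1 + j, start from a chain of k points (k new
-- minima over the empty poset), add an isolated point (e = a), add j new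
-- minima (e = a) and one more isolated point: e = a·b on b points.

open import Defs
open import Data.Nat using (ℕ; zero; suc; _+_; _*_; _≤_; _<_; s≤s; z≤n)
import Data.Nat.Properties as ℕP
open import Data.Nat.Tactic.RingSolver using (solve-∀)
open import Data.Fin using (Fin; zero; suc; punchIn; punchOut) renaming (_≤_ to _≤ᶠ_; _<_ to _<ᶠ_)
import Data.Fin.Properties as FinP
open import Data.Vec as Vec using (Vec; []; lookup; insertAt; tabulate)
import Data.Vec.Properties as VecP
open import Data.List as List using (List; length; cartesianProductWith; allFin; [_])
import Data.List.Properties as ListP
open import Data.List.Membership.Propositional using (_∈_)
import Data.List.Membership.Propositional.Properties as ∈P
open import Data.List.Relation.Unary.Unique.Propositional using (Unique)
import Data.List.Relation.Unary.Unique.Propositional.Properties as UniqueP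
open import Data.List.Relation.Unary.Any using (here)
open import Data.List.Relation.Unary.AllPairs using ([]; _∷_)
import Data.List.Relation.Unary.All as All
open import Data.Product using (_×_; _,_; ∃; ∃₂)
open import Data.Unit using (⊤; tt)
open import Data.Empty using (⊥; ⊥-elim)
open import Function.Bundles using (_⇔_; mk⇔; Equivalence)
open import Relation.Nullary using (¬_; yes; no)
open import Relation.Binary.PropositionalEquality
  using (_≡_; refl; sym; trans; cong; cong₂; subst; subst₂; isEquivalence; _≢_; module ≡-Reasoning)
open import Relation.Binary.Structures using (IsPartialOrder)

empty : Poset 0
empty = record
  { _≼_ = λ _ _ → ⊤
  ; isPartialOrder = record
    { isPreorder = record
      { isEquivalence = isEquivalence ; reflexive = λ _ → tt ; trans = λ _ _ → tt }
    ; antisym = λ {i} → ⊥-elim (FinP.¬Fin0 i) } }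

numLinExt-empty : NumLinExt empty 1
numLinExt-empty = [ [] ] , refl , (All.[] ∷ []) , λ v → mk⇔
  (λ _ → record { injective = λ () ; compatible = λ () })
  (λ _ → here (only-empty v))
  where
  only-empty : (v : Vec (Fin 0) 0) → v ≡ []
  only-empty [] = refl

adjoinRel : ∀ {m} → Set → (Fin m → Fin m → Set) → Fin (suc m) → Fin (suc m) → Set
adjoinRel D R zero    zero    = ⊤
adjoinRel D R zero    (suc _) = D
adjoinRel D R (suc _) zero    = ⊥
adjoinRel D R (suc i) (suc j) = R i j

adjoin : ∀ {m} → Set → Poset m → Poset (suc m)
adjoin {m} D P = record
  { _≼_ = adjoinRel D _≼_
  ; isPartialOrder = record
    { isPreorder = record
      { isEquivalence = isEquivalence
      ; reflexive = λ {i j} → reflexive′ {i} {j}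
      ; trans = λ {i j k} → trans′ {i} {j} {k} }
    ; antisym = λ {i j} → antisym′ {i} {j} } }
  where
  open Poset P
  module P = IsPartialOrder isPartialOrder

  reflexive′ : ∀ {i j} → i ≡ j → adjoinRel D _≼_ i j
  reflexive′ {zero}  refl = tt
  reflexive′ {suc i} refl = P.refl

  trans′ : ∀ {i j k} → adjoinRel D _≼_ i j → adjoinRel D _≼_ j k → adjoinRel D _≼_ i k
  trans′ {zero}  {zero}  {_}     _  jk = jk
  trans′ {zero}  {suc _} {zero}  _  ()
  trans′ {zero}  {suc _} {suc _} ij _  = ij
  trans′ {suc _} {zero}  {_}     () _
  trans′ {suc _} {suc _} {zero}  _  ()
  trans′ {suc _} {suc _} {suc _} ij jk = P.trans ij jk

  antisym′ : ∀ {i j} → adjoinRel D _≼_ i j → adjoinRel D _≼_ j i → i ≡ j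
  antisym′ {zero}  {zero}  _  _  = refl
  antisym′ {zero}  {suc _} _  ()
  antisym′ {suc _} {zero}  () _
  antisym′ {suc _} {suc _} ij ji = cong suc (P.antisym ij ji)

new-below : ∀ {m} {D : Set} {R : Fin m → Fin m → Set} → D → ∀ x → adjoinRel D R zero x
new-below d zero    = tt
new-below d (suc _) = d

insertNew : ∀ {m} → Vec (Fin m) m → Fin (suc m) → Vec (Fin (suc m)) (suc m)
insertNew v p = insertAt (Vec.map suc v) p zero

lookup-new : ∀ {m} (v : Vec (Fin m) m) p → lookup (insertNew v p) p ≡ zero
lookup-new v p = VecP.insertAt-lookup (Vec.map suc v) p zero

lookup-old : ∀ {m} (v : Vec (Fin m) m) p k →
             lookup (insertNew v p) (punchIn p k) ≡ suc (lookup v k)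
lookup-old v p k =
  trans (VecP.insertAt-punchIn (Vec.map suc v) p zero k) (VecP.lookup-map k suc v)

data Slot {m} (p : Fin (suc m)) : Fin (suc m) → Set where
  new : Slot p p
  old : ∀ k → Slot p (punchIn p k)

slot : ∀ {m} p (i : Fin (suc m)) → Slot p i
slot p i with p FinP.≟ i
... | yes refl = new
... | no p≢i   = subst (Slot p) (FinP.punchIn-punchOut p≢i) (old (punchOut p≢i))

zero≢suc : ∀ {m} {x : Fin m} → zero ≢ suc x
zero≢suc ()

vec-ext : ∀ {A : Set} {n} {xs ys : Vec A n} → (∀ i → lookup xs i ≡ lookup ys i) → xs ≡ ys
vec-ext {xs = xs} {ys} same = begin
  xs                   ≡⟨ sym (VecP.tabulate∘lookup xs) ⟩
  tabulate (lookup xs) ≡⟨ VecP.tabulate-cong same ⟩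
  tabulate (lookup ys) ≡⟨ VecP.tabulate∘lookup ys ⟩
  ys                   ∎
  where open ≡-Reasoning

insertNew-injective : ∀ {m} {v v′ : Vec (Fin m) m} {p p′} →
                      insertNew v p ≡ insertNew v′ p′ → v ≡ v′ × p ≡ p′
insertNew-injective {v = v} {v′} {p} {p′} eq with slot p p′
... | new   = vec-ext same , refl
  where
  open ≡-Reasoning
  same : ∀ i → lookup v i ≡ lookup v′ i
  same i = FinP.suc-injective (begin
    suc (lookup v i)                      ≡⟨ sym (lookup-old v p i) ⟩
    lookup (insertNew v p) (punchIn p i)  ≡⟨ cong (λ w → lookup w (punchIn p i)) eq ⟩
    lookup (insertNew v′ p) (punchIn p i) ≡⟨ lookup-old v′ p i ⟩
    suc (lookup v′ i)                     ∎)
... | old k = ⊥-elim (zero≢suc (begin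
  zero                                              ≡⟨ sym (lookup-new v′ (punchIn p k)) ⟩
  lookup (insertNew v′ (punchIn p k)) (punchIn p k) ≡⟨ cong (λ w → lookup w (punchIn p k)) (sym eq) ⟩
  lookup (insertNew v p) (punchIn p k)              ≡⟨ lookup-old v p k ⟩
  suc (lookup v k)                                  ∎))
  where open ≡-Reasoning

Distinct : ∀ {m} → Vec (Fin m) m → Set
Distinct w = ∀ i j → lookup w i ≡ lookup w j → i ≡ j

insertNew-distinct : ∀ {m} {v : Vec (Fin m) m} p → Distinct v → Distinct (insertNew v p)
insertNew-distinct {v = v} p distinct i j eq with slot p i | slot p j
... | new   | new   = refl
... | new   | old l = ⊥-elim (zero≢suc (trans (sym (lookup-new v p)) (trans eq (lookup-old v p l))))
... | old k | new   = ⊥-elim (zero≢suc (trans (sym (lookup-new v p)) (trans (sym eq) (lookup-old v p k))))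
... | old k | old l = cong (punchIn p) (distinct k l
  (FinP.suc-injective (trans (sym (lookup-old v p k)) (trans eq (lookup-old v p l)))))

-- A distinct list of all m + 1 points contains 0 (pigeonhole).
zero-occurs : ∀ {m} (w : Vec (Fin (suc m)) (suc m)) → Distinct w → ∃ λ p → lookup w p ≡ zero
zero-occurs {m} w distinct with FinP.any? (λ p → lookup w p FinP.≟ zero)
... | yes found = found
... | no none = ⊥-elim (collision (FinP.pigeonhole (ℕP.n<1+n m) renamed))
  where
  nonzero : ∀ i → zero ≢ lookup w i
  nonzero i eq = none (i , sym eq)

  renamed : Fin (suc m) → Fin m
  renamed i = punchOut (nonzero i)

  collision : ¬ (∃₂ λ i j → i <ᶠ j × renamed i ≡ renamed j)
  collision (i , j , i<j , same) =
    FinP.<-irrefl (distinct i j (FinP.punchOut-injective (nonzero i) (nonzero j) same)) i<j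

insertNew-onto : ∀ {m} (w : Vec (Fin (suc m)) (suc m)) → Distinct w →
                 ∃₂ λ v p → w ≡ insertNew v p
insertNew-onto w distinct with p , wp≡0 ← zero-occurs w distinct
  = v , p , vec-ext same
  where
  nonzero : ∀ k → zero ≢ lookup w (punchIn p k)
  nonzero k eq = FinP.punchInᵢ≢i p k (distinct _ _ (trans (sym eq) (sym wp≡0)))

  v : Vec (Fin _) _
  v = tabulate (λ k → punchOut (nonzero k))

  same : ∀ i → lookup w i ≡ lookup (insertNew v p) i
  same i with slot p i
  ... | new   = trans wp≡0 (sym (lookup-new v p))
  ... | old k = begin
    lookup w (punchIn p k)             ≡⟨ sym (FinP.punchIn-punchOut (nonzero k)) ⟩
    suc (punchOut (nonzero k))         ≡⟨ cong suc (sym (VecP.lookup∘tabulate _ k)) ⟩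
    suc (lookup v k)                   ≡⟨ sym (lookup-old v p k) ⟩
    lookup (insertNew v p) (punchIn p k) ∎
    where open ≡-Reasoning

module _ {m} {D : Set} {P : Poset m} {v : Vec (Fin m) m} {p : Fin (suc m)} where
  open Poset P using (_≼_)
  private
    _≼⁺_ : Fin (suc m) → Fin (suc m) → Set
    _≼⁺_ = Poset._≼_ (adjoin D P)

  linExt-insertNew : IsLinExt P v → (D → p ≡ zero) → IsLinExt (adjoin D P) (insertNew v p)
  linExt-insertNew linExt first =
    record { injective = insertNew-distinct p injective ; compatible = compatible′ }
    where
    open IsLinExt linExt
    compatible′ : ∀ i j → lookup (insertNew v p) i ≼⁺ lookup (insertNew v p) j → i ≤ᶠ j
    compatible′ i j r with slot p i | slot p j
    ... | new   | new   = FinP.≤-refl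
    ... | new   | old l = subst (_≤ᶠ punchIn p l) (sym (first d)) z≤n
      where
      d : D
      d = subst₂ _≼⁺_ (lookup-new v p) (lookup-old v p l) r
    ... | old k | new   = ⊥-elim (subst₂ _≼⁺_ (lookup-old v p k) (lookup-new v p) r)
    ... | old k | old l = FinP.punchIn-mono-≤ p k l
      (compatible k l (subst₂ _≼⁺_ (lookup-old v p k) (lookup-old v p l) r))

  linExt-insertNew⁻ : IsLinExt (adjoin D P) (insertNew v p) → IsLinExt P v × (D → p ≡ zero)
  linExt-insertNew⁻ linExt = record { injective = injective′ ; compatible = compatible′ } , first
    where
    open IsLinExt linExt
    injective′ : Distinct v
    injective′ i j eq = FinP.punchIn-injective p i j (injective _ _
      (trans (lookup-old v p i) (trans (cong suc eq) (sym (lookup-old v p j)))))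
    compatible′ : ∀ i j → lookup v i ≼ lookup v j → i ≤ᶠ j
    compatible′ i j r = FinP.punchIn-cancel-≤ p i j (compatible _ _
      (subst₂ _≼⁺_ (sym (lookup-old v p i)) (sym (lookup-old v p j)) r))
    first : D → p ≡ zero
    first d = FinP.≤-antisym (compatible p zero new≼head) z≤n
      where
      head : Fin (suc m)
      head = lookup (insertNew v p) zero
      new≼head : lookup (insertNew v p) p ≼⁺ head
      new≼head = subst (_≼⁺ head) (sym (lookup-new v p)) (new-below {R = _≼_} d head)

length-cartesianProductWith : ∀ {A B C : Set} (f : A → B → C) (xs : List A) (ys : List B) →
                              length (cartesianProductWith f xs ys) ≡ length xs * length ys
length-cartesianProductWith f List.[] ys = refl
length-cartesianProductWith f (x List.∷ xs) ys = trans (ListP.length-++ (List.map (f x) ys))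
  (cong₂ _+_ (ListP.length-map (f x) ys) (length-cartesianProductWith f xs ys))

numLinExt-adjoin : ∀ {m e} {D : Set} {P : Poset m} → NumLinExt P e →
                   (ps : List (Fin (suc m))) → Unique ps → (∀ p → (p ∈ ps) ⇔ (D → p ≡ zero)) →
                   NumLinExt (adjoin D P) (e * length ps)
numLinExt-adjoin {e = e} {D} {P} (xs , length≡e , unique , linExts) ps uniquePs admissible =
  ys , length′ , unique′ , linExts′
  where
  ys : List (Vec (Fin _) _)
  ys = cartesianProductWith insertNew xs ps

  length′ : length ys ≡ e * length ps
  length′ = trans (length-cartesianProductWith insertNew xs ps) (cong (_* length ps) length≡e)

  unique′ : Unique ys
  unique′ = UniqueP.cartesianProductWith⁺ insertNew insertNew-injective unique uniquePs

  linExts′ : ∀ w → (w ∈ ys) ⇔ IsLinExt (adjoin D P) w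
  linExts′ w = mk⇔ to from
    where
    to : w ∈ ys → IsLinExt (adjoin D P) w
    to w∈ with v , p , v∈ , p∈ , refl ← ∈P.∈-cartesianProductWith⁻ insertNew xs ps w∈
      = linExt-insertNew (Equivalence.to (linExts v) v∈) (Equivalence.to (admissible p) p∈)
    from : IsLinExt (adjoin D P) w → w ∈ ys
    from linExt with v , p , refl ← insertNew-onto w (IsLinExt.injective linExt)
                 with linExtV , first ← linExt-insertNew⁻ linExt
      = ∈P.∈-cartesianProductWith⁺ insertNew
          (Equivalence.from (linExts v) linExtV) (Equivalence.from (admissible p) first)

-- An isolated point may go anywhere: e is multiplied by m + 1.
numLinExt-isolated : ∀ {m e} {P : Poset m} → NumLinExt P e → NumLinExt (adjoin ⊥ P) (e * suc m)
numLinExt-isolated {m} {e} {P} count =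
  subst (NumLinExt (adjoin ⊥ P)) (cong (e *_) (ListP.length-tabulate (λ i → i)))
    (numLinExt-adjoin count (allFin (suc m)) (UniqueP.allFin⁺ (suc m))
      (λ p → mk⇔ (λ _ ()) (λ _ → ∈P.∈-allFin p)))

-- A new minimum must come first: e is unchanged.
numLinExt-bottom : ∀ {m e} {P : Poset m} → NumLinExt P e → NumLinExt (adjoin ⊤ P) e
numLinExt-bottom {e = e} {P} count =
  subst (NumLinExt (adjoin ⊤ P)) (ℕP.*-identityʳ e)
    (numLinExt-adjoin count [ zero ] (All.[] ∷ [])
      (λ p → mk⇔ (λ { (here refl) _ → refl }) (λ first → here (first tt))))

bottoms : ∀ {m} j → Poset m → Poset (j + m)
bottoms zero    P = P
bottoms (suc j) P = adjoin ⊤ (bottoms j P)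

numLinExt-bottoms : ∀ {m e} j {P : Poset m} → NumLinExt P e → NumLinExt (bottoms j P) e
numLinExt-bottoms zero    count = count
numLinExt-bottoms (suc j) count = numLinExt-bottom (numLinExt-bottoms j count)

corollary2p5 : (n a b : ℕ) → 1 ≤ a → a < b → n ≡ a * b → λ≤ n b
corollary2p5 n (suc k) b (s≤s z≤n) a<b n≡ab with j , refl ← ℕP.m≤n⇒∃[o]m+o≡n a<b =
  suc (j + suc (k + 0)) , ℕP.≤-reflexive size≡b , Q , subst (NumLinExt Q) count≡n count
  where
  -- a chain of k points plus an isolated point has a linear extensions
  A : Poset (suc (k + 0))
  A = adjoin ⊥ (bottoms k empty)
  -- then j new minima and another isolated point: b points in total
  Q : Poset (suc (j + suc (k + 0)))
  Q = adjoin ⊥ (bottoms j A)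

  count : NumLinExt Q (1 * suc (k + 0) * suc (j + suc (k + 0)))
  count = numLinExt-isolated (numLinExt-bottoms j
            (numLinExt-isolated (numLinExt-bottoms k numLinExt-empty)))

  size≡b : suc (j + suc (k + 0)) ≡ suc (suc k) + j
  size≡b = size-identity j k
    where
    size-identity : ∀ j k → suc (j + suc (k + 0)) ≡ suc (suc k) + j
    size-identity = solve-∀

  count≡n : 1 * suc (k + 0) * suc (j + suc (k + 0)) ≡ n
  count≡n = trans (count-identity j k) (sym n≡ab)
    where
    count-identity : ∀ j k → 1 * suc (k + 0) * suc (j + suc (k + 0)) ≡ suc k * (suc (suc k) + j)
    count-identity = solve-∀
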